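{- For every definition set $D$, choreographies $C,C'$, states $s,s_1,s_2$ and rich labels $\rho_1,\rho_2$: if $\langle C,s\rangle\xrightarrow{\rho_1}_D\langle C',s_1\rangle$ and $\langle C,s\rangle\xrightarrow{\rho_2}_D\langle C',s_2\rangle$, then $\rho_1=\rho_2$.
   Context: Fix types with decidable equality of process names $\mathsf{Pid}$, variables $\mathsf{Var}$, values $\mathsf{Val}$, expressions, Boolean expressions, procedure names $\mathsf{RecVar}$, annotations, and evaluation functions $\mathrm{eval}$ (expression and local state $\mathsf{Var}\to\mathsf{Val}$ to value) and $\mathrm{beval}$ (Boolean expression and local state to Boolean), invariant under extensional equality of local states. Labels: $\mathsf{left},\mathsf{right}$. A state is $s:\mathsf{Pid}\to\mathsf{Var}\to\mathsf{Val}$; $s\equiv s'$ is extensional equality; $s[q,x\mapsto v]$ is update. Interactions $\eta::=p.e\to q.x\mid p\to q[l]$ (processes $\{p,q\}$); choreographies $C::=\eta@a;C\mid\mathsf{if}\ p.b\ \mathsf{then}\ C_1\ \mathsf{else}\ C_2\mid\mathsf{call}\ X\mid\mathsf{rtcall}\ X\ ps\ C\mid\mathsf{end}$, $ps$ a list of processes. A definition set is $D:\mathsf{RecVar}\to\mathrm{list}(\mathsf{Pid})\times\mathsf{Chor}$, $D\,X=(\mathrm{Vars}\,X,\mathrm{Body}\,X)$. Rich labels $\mathrm{com}(p,v,q,x),\mathrm{sel}(p,q,l),\mathrm{cond}(p),\mathrm{call}(X,p)$ with processes $\{p,q\},\{p,q\},\{p\},\{p\}$. $\langle C,s\rangle\xrightarrow{\rho}_D\langle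 C',s'\rangle$ is the least relation with: $\langle p.e\to q.x@a;C,s\rangle\xrightarrow{\mathrm{com}(p,v,q,x)}\langle C,s'\rangle$ if $v=\mathrm{eval}(e,s\,p)$, $s'\equiv s[q,x\mapsto v]$; $\langle p\to q[l]@a;C,s\rangle\xrightarrow{\mathrm{sel}(p,q,l)}\langle C,s'\rangle$ if $s\equiv s'$; $\langle\mathsf{if}\ p.b\ \mathsf{then}\ C_1\ \mathsf{else}\ C_2,s\rangle\xrightarrow{\mathrm{cond}(p)}\langle C_1,s'\rangle$ (resp. $C_2$) if $\mathrm{beval}(b,s\,p)$ is true (resp. false), $s\equiv s'$; $\langle\eta@a;C,s\rangle\xrightarrow{\rho}\langle\eta@a;C',s'\rangle$ if $\langle C,s\rangle\xrightarrow{\rho}\langle C',s'\rangle$ and processes of $\eta$, $\rho$ are disjoint; $\langle\mathsf{if}\ p.b\ \mathsf{then}\ C_1\ \mathsf{else}\ C_2,s\rangle\xrightarrow{\rho}\langle\mathsf{if}\ p.b\ \mathsf{then}\ C_1'\ \mathsf{else}\ C_2',s'\rangle$ if $p$ not in $\rho$ and $\langle C_i,s\rangle\xrightarrow{\rho}\langle C_i',s'\rangle$, $i=1,2$; $\langle\mathsf{rtcall}\ X\ ps\ C,s\rangle\xrightarrow{\rho}\langle\mathsf{rtcall}\ X\ ps\ C',s'\rangle$ if no process of $\rho$ is in $ps$ and $\langle C,s\rangle\xrightarrow{\rho}\langle C',s'\rangle$; for $s\equiv s'$, $p\in\mathrm{Vars}\,X$: $\langle\mathsf{call}\ X,s\rangle\xrightarrow{\mathrm{call}(X,p)}\langle\mathrm{Body}\,X,s'\rangle$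 if $\#\mathrm{Vars}\,X=1$, and $\langle\mathsf{rtcall}\ X\ (\mathrm{Vars}\,X\setminus p)\ (\mathrm{Body}\,X),s'\rangle$ if $\#\mathrm{Vars}\,X>1$; for $s\equiv s'$, $p\in ps$: $\langle\mathsf{rtcall}\ X\ ps\ C,s\rangle\xrightarrow{\mathrm{call}(X,p)}\langle\mathsf{rtcall}\ X\ (ps\setminus p)\ C,s'\rangle$ if $\#ps>1$ and $\langle C,s'\rangle$ if $\#ps=1$ ($\#$ is list size, $\setminus p$ removes $p$). -}

module Defs where

open import Data.Bool using (Bool; true; false)
open import Data.List using (List; []; _∷_; length; filter)
open import Data.List.Membership.Propositional using (_∈_; _∉_)
open import Data.Nat using (ℕ; _>_)
open import Data.Product using (_×_; _,_; proj₁; proj₂)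
open import Relation.Binary.PropositionalEquality using (_≡_)
open import Relation.Nullary using (¬_; Dec; yes; no)
open import Relation.Nullary.Decidable using (¬?)
open import Level using (0ℓ)

record Params : Set₁ where
  field
    Pid RecVar Var Val Expr BExpr Ann : Set
    _≟P_ : (p q : Pid) → Dec (p ≡ q)
    _≟V_ : (x y : Var) → Dec (x ≡ y)
    _≟Val_ : (u v : Val) → Dec (u ≡ v)
    _≟E_ : (e f : Expr) → Dec (e ≡ f)
    _≟B_ : (b c : BExpr) → Dec (b ≡ c)
    _≟R_ : (X Y : RecVar) → Dec (X ≡ Y)
    _≟A_ : (a c : Ann) → Dec (a ≡ c)
    eval : Expr → (Var → Val) → Val
    beval : BExpr → (Var → Val) → Bool
    eval-ext : ∀ e (f g : Var → Val) → (∀ x → f x ≡ g x) → eval e f ≡ eval e g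
    beval-ext : ∀ b (f g : Var → Val) → (∀ x → f x ≡ g x) → beval b f ≡ beval b g

module Chor (P : Params) where
  open Params P

  data Label : Set where
    left right : Label

  data Eta : Set where
    com : Pid → Expr → Pid → Var → Eta    -- p.e → q.x
    sel : Pid → Pid → Label → Eta         -- p → q[l]

  pnEta : Eta → List Pid
  pnEta (com p e q x) = p ∷ q ∷ []
  pnEta (sel p q l) = p ∷ q ∷ []

  data Choreography : Set where
    _at_⨾_ : Eta → Ann → Choreography → Choreography
    If_∙_Then_Else_ : Pid → BExpr → Choreography → Choreography → Choreography
    Call : RecVar → Choreography
    RTCall : RecVar → List Pid → Choreography → Choreography
    End : Choreography

  DefSet : Set
  DefSet = RecVar → List Pid × Choreography

  Vars : DefSet → RecVar → List Pid
  Vars D X = proj₁ (D X)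

  Body : DefSet → RecVar → Choreography
  Body D X = proj₂ (D X)

  State : Set
  State = Pid → Var → Val

  _≡ₛ_ : State → State → Set
  s ≡ₛ s' = ∀ p x → s p x ≡ s' p x

  update : State → Pid → Var → Val → State
  update s q x v p y with p ≟P q | y ≟V x
  ... | yes _ | yes _ = v
  ... | _ | _ = s p y

  _∖_ : List Pid → Pid → List Pid
  ps ∖ p = filter (λ r → ¬? (r ≟P p)) ps

  data RichLabel : Set where
    rcom : Pid → Val → Pid → Var → RichLabel
    rsel : Pid → Pid → Label → RichLabel
    rcond : Pid → RichLabel
    rcall : RecVar → Pid → RichLabel

  pnRL : RichLabel → List Pid
  pnRL (rcom p v q x) = p ∷ q ∷ []
  pnRL (rsel p q l) = p ∷ q ∷ []
  pnRL (rcond p) = p ∷ []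
  pnRL (rcall X p) = p ∷ []

  Disjoint : List Pid → List Pid → Set
  Disjoint xs ys = ∀ {r} → r ∈ xs → r ∉ ys

  data Step (D : DefSet) : Choreography → State → RichLabel → Choreography → State → Set where
    s-com : ∀ {p e q x a C s s' v} → v ≡ eval e (s p) → s' ≡ₛ update s q x v →
            Step D (com p e q x at a ⨾ C) s (rcom p v q x) C s'
    s-sel : ∀ {p q l a C s s'} → s ≡ₛ s' →
            Step D (sel p q l at a ⨾ C) s (rsel p q l) C s'
    s-then : ∀ {p b C₁ C₂ s s'} → beval b (s p) ≡ true → s ≡ₛ s' →
             Step D (If p ∙ b Then C₁ Else C₂) s (rcond p) C₁ s'
    s-else : ∀ {p b C₁ C₂ s s'} → beval b (s p) ≡ false → s ≡ₛ s' →
             Step D (If p ∙ b Then C₁ Else C₂) s (rcond p) C₂ s'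
    s-delay-eta : ∀ {η a C C' s s' ρ} → Disjoint (pnEta η) (pnRL ρ) →
                  Step D C s ρ C' s' →
                  Step D (η at a ⨾ C) s ρ (η at a ⨾ C') s'
    s-delay-cond : ∀ {p b C₁ C₂ C₁' C₂' s s' ρ} → p ∉ pnRL ρ →
                   Step D C₁ s ρ C₁' s' → Step D C₂ s ρ C₂' s' →
                   Step D (If p ∙ b Then C₁ Else C₂) s ρ (If p ∙ b Then C₁' Else C₂') s'
    s-delay-rt : ∀ {X ps C C' s s' ρ} → Disjoint (pnRL ρ) ps →
                 Step D C s ρ C' s' →
                 Step D (RTCall X ps C) s ρ (RTCall X ps C') s'
    s-call-one : ∀ {X p s s'} → s ≡ₛ s' → p ∈ Vars D X → length (Vars D X) ≡ 1 →
                 Step D (Call X) s (rcall X p) (Body D X) s'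
    s-call-many : ∀ {X p s s'} → s ≡ₛ s' → p ∈ Vars D X → length (Vars D X) > 1 →
                  Step D (Call X) s (rcall X p) (RTCall X (Vars D X ∖ p) (Body D X)) s'
    s-rt-many : ∀ {X ps C p s s'} → s ≡ₛ s' → p ∈ ps → length ps > 1 →
                Step D (RTCall X ps C) s (rcall X p) (RTCall X (ps ∖ p) C) s'
    s-rt-one : ∀ {X ps C p s s'} → s ≡ₛ s' → p ∈ ps → length ps ≡ 1 →
               Step D (RTCall X ps C) s (rcall X p) C s'

-- The proof is by simultaneous induction on the two derivations, using the
-- common reduct to tell the rules apart. A delay rule keeps the interaction,
-- guard or runtime call in the reduct, whereas the rule consuming it discards
-- it; the reduct of a delayed step cannot coincide with the continuation, since
-- the step would then have to consume that prefix after all, which disjointness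
-- forbids. Two calls of the same procedure that both fire determine the caller:
-- either the list of waiting processes is a singleton, or the caller p is read
-- off the remaining list ps ∖ p.
module Submission where

open import Defs
open import Data.List using (List; []; _∷_; length)
open import Data.List.Membership.Propositional using (_∈_; _∉_)
open import Data.List.Membership.Propositional.Properties using (∈-filter⁺; ∈-filter⁻)
open import Data.List.Relation.Unary.Any using (here; there)
open import Data.Nat.Properties using (<⇒≢)
open import Data.Product using (_,_)
open import Data.Empty using (⊥; ⊥-elim)
open import Relation.Binary.PropositionalEquality using (_≡_; _≢_; refl; sym; subst; cong)
open import Relation.Nullary using (yes; no)
open import Relation.Nullary.Decidable using (¬?)

module _ (P : Params) where
  open Params P
  open Chor P

  ∉-∖ : ∀ {p} ps → p ∉ ps ∖ p
  ∉-∖ {p} ps p∈ps∖p with ∈-filter⁻ (λ r → ¬? (r ≟P p)) {xs = ps} p∈ps∖p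
  ... | _ , p≢p = p≢p refl

  ∈-∖⁺ : ∀ {p q} ps → q ∈ ps → q ≢ p → q ∈ ps ∖ p
  ∈-∖⁺ {p} ps = ∈-filter⁺ (λ r → ¬? (r ≟P p))

  ∖-≢ : ∀ {p} ps → p ∈ ps → ps ∖ p ≢ ps
  ∖-≢ {p} ps p∈ps eq = ∉-∖ ps (subst (p ∈_) (sym eq) p∈ps)

  ∖-injective : ∀ {p q} ps → p ∈ ps → q ∈ ps → ps ∖ p ≡ ps ∖ q → p ≡ q
  ∖-injective {p} {q} ps p∈ps q∈ps eq with q ≟P p
  ... | yes q≡p = sym q≡p
  ... | no q≢p = ⊥-elim (∉-∖ ps (subst (q ∈_) eq (∈-∖⁺ ps q∈ps q≢p)))

  ∈-length-1-unique : ∀ {p q} (ps : List Pid) → length ps ≡ 1 → p ∈ ps → q ∈ ps → p ≡ q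
  ∈-length-1-unique (_ ∷ []) _ (here refl) (here refl) = refl

  RTCall-injectiveₚₛ : ∀ {X Y ps qs C C'} → RTCall X ps C ≡ RTCall Y qs C' → ps ≡ qs
  RTCall-injectiveₚₛ refl = refl

  ¬step-dropping-η : ∀ {D η a C s s' ρ} →
    Disjoint (pnEta η) (pnRL ρ) → Step D (η at a ⨾ C) s ρ C s' → ⊥
  ¬step-dropping-η disj (s-com _ _) = disj (here refl) (here refl)
  ¬step-dropping-η disj (s-sel _) = disj (here refl) (here refl)
  ¬step-dropping-η disj (s-delay-eta _ step) = ¬step-dropping-η disj step

  ¬step-to-then : ∀ {D p b C₁ C₂ s s' ρ} →
    p ∉ pnRL ρ → Step D (If p ∙ b Then C₁ Else C₂) s ρ C₁ s' → ⊥
  ¬step-to-then p∉ρ (s-then _ _) = p∉ρ (here refl)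
  ¬step-to-then p∉ρ (s-else _ _) = p∉ρ (here refl)
  ¬step-to-then p∉ρ (s-delay-cond _ step _) = ¬step-to-then p∉ρ step

  ¬step-to-else : ∀ {D p b C₁ C₂ s s' ρ} →
    p ∉ pnRL ρ → Step D (If p ∙ b Then C₁ Else C₂) s ρ C₂ s' → ⊥
  ¬step-to-else p∉ρ (s-then _ _) = p∉ρ (here refl)
  ¬step-to-else p∉ρ (s-else _ _) = p∉ρ (here refl)
  ¬step-to-else p∉ρ (s-delay-cond _ _ step) = ¬step-to-else p∉ρ step

  ¬step-dropping-RTCall : ∀ {D X ps C s s' ρ} →
    Disjoint (pnRL ρ) ps → Step D (RTCall X ps C) s ρ C s' → ⊥
  ¬step-dropping-RTCall disj (s-delay-rt _ step) = ¬step-dropping-RTCall disj step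
  ¬step-dropping-RTCall disj (s-rt-one _ p∈ps _) = disj (here refl) p∈ps

  -- The reducts are kept apart and related by an equation, since unifying
  -- RTCall X ps C with RTCall X (ps ∖ p) C would get stuck on ps ∖ p.
  step-label-unique : ∀ {D C C₁ C₂ s s₁ s₂ ρ₁ ρ₂} →
    Step D C s ρ₁ C₁ s₁ → Step D C s ρ₂ C₂ s₂ → C₁ ≡ C₂ → ρ₁ ≡ ρ₂
  step-label-unique (s-com refl _) (s-com refl _) _ = refl
  step-label-unique (s-sel _) (s-sel _) _ = refl
  step-label-unique (s-com _ _) (s-delay-eta disj step) refl = ⊥-elim (¬step-dropping-η disj step)
  step-label-unique (s-sel _) (s-delay-eta disj step) refl = ⊥-elim (¬step-dropping-η disj step)
  step-label-unique (s-delay-eta disj step) (s-com _ _) refl = ⊥-elim (¬step-dropping-η disj step)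
  step-label-unique (s-delay-eta disj step) (s-sel _) refl = ⊥-elim (¬step-dropping-η disj step)
  step-label-unique (s-delay-eta _ step₁) (s-delay-eta _ step₂) refl = step-label-unique step₁ step₂ refl
  step-label-unique (s-then _ _) (s-then _ _) _ = refl
  step-label-unique (s-then _ _) (s-else _ _) _ = refl
  step-label-unique (s-else _ _) (s-then _ _) _ = refl
  step-label-unique (s-else _ _) (s-else _ _) _ = refl
  step-label-unique (s-then _ _) (s-delay-cond p∉ρ step _) refl = ⊥-elim (¬step-to-then p∉ρ step)
  step-label-unique (s-else _ _) (s-delay-cond p∉ρ _ step) refl = ⊥-elim (¬step-to-else p∉ρ step)
  step-label-unique (s-delay-cond p∉ρ step _) (s-then _ _) refl = ⊥-elim (¬step-to-then p∉ρ step)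
  step-label-unique (s-delay-cond p∉ρ _ step) (s-else _ _) refl = ⊥-elim (¬step-to-else p∉ρ step)
  step-label-unique (s-delay-cond _ step₁ _) (s-delay-cond _ step₂ _) refl = step-label-unique step₁ step₂ refl
  step-label-unique (s-delay-rt _ step₁) (s-delay-rt _ step₂) refl = step-label-unique step₁ step₂ refl
  step-label-unique (s-delay-rt _ _) (s-rt-many _ p∈ps _) eq =
    ⊥-elim (∖-≢ _ p∈ps (sym (RTCall-injectiveₚₛ eq)))
  step-label-unique (s-rt-many _ p∈ps _) (s-delay-rt _ _) eq =
    ⊥-elim (∖-≢ _ p∈ps (RTCall-injectiveₚₛ eq))
  step-label-unique (s-delay-rt disj step) (s-rt-one _ _ _) refl = ⊥-elim (¬step-dropping-RTCall disj step)
  step-label-unique (s-rt-one _ _ _) (s-delay-rt disj step) refl = ⊥-elim (¬step-dropping-RTCall disj step)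
  step-label-unique (s-rt-many _ p∈ps _) (s-rt-many _ q∈ps _) eq =
    cong (rcall _) (∖-injective _ p∈ps q∈ps (RTCall-injectiveₚₛ eq))
  step-label-unique (s-rt-one _ p∈ps #ps≡1) (s-rt-one _ q∈ps _) _ =
    cong (rcall _) (∈-length-1-unique _ #ps≡1 p∈ps q∈ps)
  step-label-unique (s-call-one _ p∈Vars #Vars≡1) (s-call-one _ q∈Vars _) _ =
    cong (rcall _) (∈-length-1-unique _ #Vars≡1 p∈Vars q∈Vars)
  step-label-unique (s-call-many _ p∈Vars _) (s-call-many _ q∈Vars _) eq =
    cong (rcall _) (∖-injective _ p∈Vars q∈Vars (RTCall-injectiveₚₛ eq))
  step-label-unique (s-call-one _ _ #Vars≡1) (s-call-many _ _ #Vars>1) _ = ⊥-elim (<⇒≢ #Vars>1 (sym #Vars≡1))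
  step-label-unique (s-call-many _ _ #Vars>1) (s-call-one _ _ #Vars≡1) _ = ⊥-elim (<⇒≢ #Vars>1 (sym #Vars≡1))
  step-label-unique (s-rt-many _ _ _) (s-rt-one _ _ _) ()
  step-label-unique (s-rt-one _ _ _) (s-rt-many _ _ _) ()

mainTheorem6 : (P : Params) → let open Chor P in
    ∀ (D : DefSet) (C C' : Choreography) (s s₁ s₂ : State) (ρ₁ ρ₂ : RichLabel) →
      Step D C s ρ₁ C' s₁ → Step D C s ρ₂ C' s₂ → ρ₁ ≡ ρ₂
mainTheorem6 P D C C' s s₁ s₂ ρ₁ ρ₂ step₁ step₂ = step-label-unique P step₁ step₂ refl
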